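{- For a finite multigraph $G=(V,E)$, set $\lambda_i=1+(d_i-1)\beta$ for $i\in V$. Then $$\omega_G(\beta)=\Xi_G(-\beta,\boldsymbol\lambda),$$ i.e. $\omega_G(\beta)=\sum_{\mathbf D}(-\beta)^{|\mathbf D|}\prod_{i\in V\setminus[\mathbf D]}\big(1+(d_i-1)\beta\big)$, the sum over all matchings $\mathbf D$ of $G$.
   Context: Loops count $2$ towards degrees $d_i$. $f_0=1,f_1=0,f_{n+1}(x)=xf_n(x)+f_{n-1}(x)$; $\theta_G(\beta,\gamma)=\sum_{s\subset E}\beta^{|s|}\prod_{i}f_{d_i(s)}(\gamma)$ ($d_i(s)$ the degree in $(V,s)$); $\omega_G(\beta)=\theta_G(\beta,2\sqrt{ -1})/(1-\beta)^{|E|-|V|}$. A matching is a set of non-loop edges no two of which share a vertex (the empty set included); $[\mathbf D]$ is the set of vertices covered by $\mathbf D$. The monomer-dimer partition function with uniform dimer weight $\mu$ and monomer weights $\boldsymbol\lambda$ is $\Xi_G(\mu,\boldsymbol\lambda)=\sum_{\mathbf D}\mu^{|\mathbf D|}\prod_{i\in V\setminus[\mathbf D]}\lambda_i$. -}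

module Defs where

open import Level using (Level)
open import Data.Nat using (ℕ; zero; suc; _∸_ ; _≤_ ; _<_ ; _≤?_) renaming (_+_ to _+ℕ_)
open import Relation.Nullary using (yes; no)
open import Data.Bool using (Bool; true; false; if_then_else_; _∧_; _∨_; not)
open import Data.Fin using (Fin; zero; suc; _≟_)
open import Data.Fin.Subset using (Subset; inside; outside; ∣_∣)
open import Data.Vec using (Vec; []; _∷_; lookup)
open import Data.Product using (_×_; _,_; proj₁; proj₂)
open import Relation.Nullary.Decidable using (⌊_⌋)
open import Algebra.Bundles using (CommutativeRing)

-- A finite multigraph G = (V, E): V = Fin n, E = Fin m, and edge e has
-- (unordered) endpoints ends e = (a , b); loops (a = b) and parallel edges allowed.
record Multigraph : Set where
  field
    n    : ℕ
    m    : ℕ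
    ends : Fin m → Fin n × Fin n

allFin : (k : ℕ) → (Fin k → Bool) → Bool
allFin zero    p = true
allFin (suc k) p = p zero ∧ allFin k (λ i → p (suc i))

anyFin : (k : ℕ) → (Fin k → Bool) → Bool
anyFin zero    p = false
anyFin (suc k) p = p zero ∨ anyFin k (λ i → p (suc i))

sumℕ : (k : ℕ) → (Fin k → ℕ) → ℕ
sumℕ zero    f = 0
sumℕ (suc k) f = f zero +ℕ sumℕ k (λ i → f (suc i))

module _ (G : Multigraph) where
  open Multigraph G

  inS : Subset m → Fin m → Bool
  inS s e = lookup s e

  -- number of endpoints of edge e equal to vertex i (a loop counts 2)
  incid : Fin n → Fin m → ℕ
  incid i e = (if ⌊ proj₁ (ends e) ≟ i ⌋ then 1 else 0)
            +ℕ (if ⌊ proj₂ (ends e) ≟ i ⌋ then 1 else 0)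

  degIn : Subset m → Fin n → ℕ
  degIn s i = sumℕ m (λ e → if inS s e then incid i e else 0)

  deg : Fin n → ℕ
  deg i = sumℕ m (λ e → incid i e)

  isLoop : Fin m → Bool
  isLoop e = ⌊ proj₁ (ends e) ≟ proj₂ (ends e) ⌋

  touches : Fin n → Fin m → Bool
  touches i e = ⌊ proj₁ (ends e) ≟ i ⌋ ∨ ⌊ proj₂ (ends e) ≟ i ⌋

  share : Fin m → Fin m → Bool
  share e e' = anyFin n (λ i → touches i e ∧ touches i e')

  isMatching : Subset m → Bool
  isMatching D =
    allFin m (λ e → not (inS D e) ∨ not (isLoop e))
    ∧ allFin m (λ e → allFin m (λ e' →
        not (inS D e ∧ inS D e' ∧ not ⌊ e ≟ e' ⌋) ∨ not (share e e')))

  covered : Subset m → Fin n → Bool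
  covered D i = anyFin m (λ e → inS D e ∧ touches i e)

module Ring {c ℓ : Level} (R : CommutativeRing c ℓ) where
  open CommutativeRing R hiding (zero)

  pow : Carrier → ℕ → Carrier
  pow x zero    = 1#
  pow x (suc k) = x * pow x k

  fromℕ : ℕ → Carrier
  fromℕ zero    = 0#
  fromℕ (suc k) = 1# + fromℕ k

  sumR : (k : ℕ) → (Fin k → Carrier) → Carrier
  sumR zero    f = 0#
  sumR (suc k) f = f zero + sumR k (λ i → f (suc i))

  prodR : (k : ℕ) → (Fin k → Carrier) → Carrier
  prodR zero    f = 1#
  prodR (suc k) f = f zero * prodR k (λ i → f (suc i))

  sumSub : (k : ℕ) → (Subset k → Carrier) → Carrier
  sumSub zero    f = f []
  sumSub (suc k) f = sumSub k (λ s → f (outside ∷ s)) + sumSub k (λ s → f (inside ∷ s))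

  fpoly : ℕ → Carrier → Carrier
  fpoly zero          x = 1#
  fpoly (suc zero)    x = 0#
  fpoly (suc (suc k)) x = x * fpoly (suc k) x + fpoly k x

  module _ (G : Multigraph) where
    open Multigraph G

    theta : Carrier → Carrier → Carrier
    theta β γ = sumSub m (λ s → pow β ∣ s ∣ * prodR n (λ i → fpoly (degIn G s i) γ))

    -- ω_G(β) = θ_G(β, 2ι) / (1-β)^{|E|-|V|}, with ι a square root of -1 and
    -- u playing the role of (1-β)⁻¹ (only used when |E| > |V|)
    omega : (ι β u : Carrier) → Carrier
    omega ι β u with m ≤? n
    ... | yes _ = theta β (ι + ι) * pow (1# - β) (n ∸ m)
    ... | no  _ = theta β (ι + ι) * pow u (m ∸ n)

    Xi : Carrier → (Fin n → Carrier) → Carrier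
    Xi μ w = sumSub m (λ D → if isMatching G D
               then pow μ ∣ D ∣ * prodR n (λ i → if covered G D i then 1# else w i)
               else 0#)

    lam : Carrier → Fin n → Carrier
    lam β i = 1# + (fromℕ (deg G i) - 1#) * β

module Submission where

-- With ι² = -1 the polynomials f_d satisfy f_{d+1}(2ι) = ι (f_d(2ι) - ι^d).  Both sides are
-- generalised to a set S of active vertices: in θ an inactive vertex i contributes ι^{d_i(s)}
-- in place of f_{d_i(s)}(2ι), and in Ξ it may not be covered and has weight 1 when uncovered.
-- Deleting an edge e = ab gives the same recurrence on both sides (right-hand sides for G - e):
--   θ_G^S = (1-β) θ^S + β[a∈S] θ^{S-a} + β[b∈S] θ^{S-b} -      β [a∈S][b∈S-a] θ^{S-a-b},
--   Ξ_G^S =       Ξ^S + β[a∈S] Ξ^{S-a} + β[b∈S] Ξ^{S-b} - β(1-β)[a∈S][b∈S-a] Ξ^{S-a-b},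
-- the first from the recursion for f at a and at b, the second from the deletion recurrence of
-- the matching polynomial and the growth of λ_a, λ_b by β.  Induction on |E| then gives
-- (1-β)^j θ_G^S = (1-β)^k Ξ_G^S whenever j + |E| = k + |S|, which for S = V is the theorem,
-- whether |E| ≤ |V| or |E| > |V|.

open import Defs
open import Level using (Level)
open import Algebra.Bundles using (CommutativeRing; CommutativeMonoid)
open import Algebra.Solver.Ring.AlmostCommutativeRing
  using (fromCommutativeRing; _-Raw-AlmostCommutative⟶_)
import Algebra.Solver.IdempotentCommutativeMonoid as ICM
open import Data.Bool using (Bool; true; false; if_then_else_; _∧_; _∨_; not)
open import Data.Bool.Properties
  using (∧-comm; ∧-identityʳ; ∧-zeroʳ; ∨-zeroʳ; ∧-conicalˡ; ∧-conicalʳ; ∨-conicalˡ; ∨-conicalʳ; not-injective;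
         ∧-commutativeMonoid; ∧-idempotentCommutativeMonoid)
open import Data.Empty using (⊥-elim)
open import Data.Fin using (Fin; zero; suc; _≟_)
open import Data.Fin.Subset using (Subset; inside; outside; ∣_∣)
open import Data.Integer as ℤ using (ℤ; +_; -[1+_])
import Data.Integer.Properties as ℤ
open import Data.Maybe using (Maybe; just; nothing)
open import Data.Nat as ℕ using (ℕ; zero; suc; _<_; _≤?_; _∸_)
import Data.Nat.Properties as ℕ
open import Data.Product using (_×_; _,_; proj₁; proj₂; ∃)
open import Data.Sign as Sign using (Sign)
open import Data.Vec using ([]; _∷_; lookup)
open import Function using (_∘_)
open import Relation.Nullary using (Dec; yes; no)
open import Relation.Nullary.Decidable using (⌊_⌋; ⌊⌋-map′)
open import Relation.Binary.PropositionalEquality as ≡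
  using (_≡_; _≢_; _≗_; cong; cong₂; ≡-≟-identity; ≢-≟-identity)
open import Algebra.Properties.CommutativeSemigroup (CommutativeMonoid.commutativeSemigroup ∧-commutativeMonoid)
  using () renaming (interchange to ∧-interchange)

module ℤ-Solver {c ℓ : Level} (R : CommutativeRing c ℓ) where
  open CommutativeRing R hiding (zero)
  open import Algebra.Properties.Ring ring using (-0#≈0#; -‿involutive; -‿+-comm; -1*x≈-x)
  open import Algebra.Properties.CommutativeSemigroup +-commutativeSemigroup
    using () renaming (interchange to +-interchange)
  open import Algebra.Properties.CommutativeSemigroup *-commutativeSemigroup
    using () renaming (interchange to *-interchange)
  open import Algebra.Properties.Semiring.Mult.TCOptimised semiring
    using (1+×; ×-homo-+; ×1-homo-*) renaming (_×_ to _×′_)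
  open import Relation.Binary.Reasoning.Setoid setoid

  ⟦_⟧ℤ : ℤ → Carrier
  ⟦ + n ⟧ℤ      = n ×′ 1#
  ⟦ -[1+ n ] ⟧ℤ = - (suc n ×′ 1#)

  ⟦_⟧ₛ : Sign → Carrier
  ⟦ Sign.+ ⟧ₛ = 1#
  ⟦ Sign.- ⟧ₛ = - 1#

  1+x-[1+y]≈x-y : ∀ x y → (1# + x) - (1# + y) ≈ x - y
  1+x-[1+y]≈x-y x y = begin
    (1# + x) + - (1# + y)     ≈⟨ +-congˡ (-‿+-comm 1# y) ⟨
    (1# + x) + (- 1# + - y)   ≈⟨ +-interchange 1# x (- 1#) (- y) ⟩
    (1# - 1#) + (x - y)       ≈⟨ +-congʳ (-‿inverseʳ 1#) ⟩
    0# + (x - y)              ≈⟨ +-identityˡ _ ⟩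
    x - y                     ∎

  ⟦⊖⟧ : ∀ m n → ⟦ m ℤ.⊖ n ⟧ℤ ≈ m ×′ 1# - n ×′ 1#
  ⟦⊖⟧ zero    zero    = sym (-‿inverseʳ 0#)
  ⟦⊖⟧ (suc m) zero    = sym (trans (+-congˡ -0#≈0#) (+-identityʳ _))
  ⟦⊖⟧ zero    (suc n) = sym (+-identityˡ _)
  ⟦⊖⟧ (suc m) (suc n) = begin
    ⟦ suc m ℤ.⊖ suc n ⟧ℤ          ≡⟨ cong ⟦_⟧ℤ (ℤ.[1+m]⊖[1+n]≡m⊖n m n) ⟩
    ⟦ m ℤ.⊖ n ⟧ℤ                  ≈⟨ ⟦⊖⟧ m n ⟩
    m ×′ 1# - n ×′ 1#               ≈⟨ 1+x-[1+y]≈x-y _ _ ⟨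
    (1# + m ×′ 1#) - (1# + n ×′ 1#) ≈⟨ +-cong (1+× m 1#) (-‿cong (1+× n 1#)) ⟨
    suc m ×′ 1# - suc n ×′ 1#       ∎

  ⟦+⟧ : ∀ i j → ⟦ i ℤ.+ j ⟧ℤ ≈ ⟦ i ⟧ℤ + ⟦ j ⟧ℤ
  ⟦+⟧ (+ m)    (+ n)    = ×-homo-+ 1# m n
  ⟦+⟧ (+ m)    -[1+ n ] = ⟦⊖⟧ m (suc n)
  ⟦+⟧ -[1+ m ] (+ n)    = trans (⟦⊖⟧ n (suc m)) (+-comm _ _)
  ⟦+⟧ -[1+ m ] -[1+ n ] = begin
    - (suc (suc (m ℕ.+ n)) ×′ 1#)      ≡⟨ cong (λ k → - (k ×′ 1#)) (ℕ.+-suc (suc m) n) ⟨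
    - ((suc m ℕ.+ suc n) ×′ 1#)        ≈⟨ -‿cong (×-homo-+ 1# (suc m) (suc n)) ⟩
    - (suc m ×′ 1# + suc n ×′ 1#)       ≈⟨ -‿+-comm _ _ ⟨
    - (suc m ×′ 1#) + - (suc n ×′ 1#)   ∎

  ⟦-⟧ : ∀ i → ⟦ ℤ.- i ⟧ℤ ≈ - ⟦ i ⟧ℤ
  ⟦-⟧ (+ zero)  = sym -0#≈0#
  ⟦-⟧ (+ suc n) = refl
  ⟦-⟧ -[1+ n ]  = sym (-‿involutive _)

  ⟦◃⟧ : ∀ s n → ⟦ s ℤ.◃ n ⟧ℤ ≈ ⟦ s ⟧ₛ * (n ×′ 1#)
  ⟦◃⟧ s      zero    = sym (zeroʳ _)
  ⟦◃⟧ Sign.+ (suc n) = sym (*-identityˡ _)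
  ⟦◃⟧ Sign.- (suc n) = sym (-1*x≈-x _)

  ⟦sign◃abs⟧ : ∀ i → ⟦ i ⟧ℤ ≈ ⟦ ℤ.sign i ⟧ₛ * (ℤ.∣ i ∣ ×′ 1#)
  ⟦sign◃abs⟧ (+ n)    = sym (*-identityˡ _)
  ⟦sign◃abs⟧ -[1+ n ] = sym (-1*x≈-x _)

  ⟦*⟧ₛ : ∀ s t → ⟦ s Sign.* t ⟧ₛ ≈ ⟦ s ⟧ₛ * ⟦ t ⟧ₛ
  ⟦*⟧ₛ Sign.+ t      = sym (*-identityˡ _)
  ⟦*⟧ₛ Sign.- Sign.+ = sym (*-identityʳ _)
  ⟦*⟧ₛ Sign.- Sign.- = sym (trans (-1*x≈-x _) (-‿involutive _))

  ⟦*⟧ : ∀ i j → ⟦ i ℤ.* j ⟧ℤ ≈ ⟦ i ⟧ℤ * ⟦ j ⟧ℤ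
  ⟦*⟧ i j = begin
    ⟦ ℤ.sign i Sign.* ℤ.sign j ℤ.◃ ℤ.∣ i ∣ ℕ.* ℤ.∣ j ∣ ⟧ℤ
      ≈⟨ ⟦◃⟧ (ℤ.sign i Sign.* ℤ.sign j) (ℤ.∣ i ∣ ℕ.* ℤ.∣ j ∣) ⟩
    ⟦ ℤ.sign i Sign.* ℤ.sign j ⟧ₛ * ((ℤ.∣ i ∣ ℕ.* ℤ.∣ j ∣) ×′ 1#)
      ≈⟨ *-cong (⟦*⟧ₛ (ℤ.sign i) (ℤ.sign j)) (×1-homo-* ℤ.∣ i ∣ ℤ.∣ j ∣) ⟩
    (⟦ ℤ.sign i ⟧ₛ * ⟦ ℤ.sign j ⟧ₛ) * ((ℤ.∣ i ∣ ×′ 1#) * (ℤ.∣ j ∣ ×′ 1#))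
      ≈⟨ *-interchange _ _ _ _ ⟩
    (⟦ ℤ.sign i ⟧ₛ * (ℤ.∣ i ∣ ×′ 1#)) * (⟦ ℤ.sign j ⟧ₛ * (ℤ.∣ j ∣ ×′ 1#))
      ≈⟨ *-cong (⟦sign◃abs⟧ i) (⟦sign◃abs⟧ j) ⟨
    ⟦ i ⟧ℤ * ⟦ j ⟧ℤ ∎

  ℤ⟶R : ℤ.+-*-rawRing -Raw-AlmostCommutative⟶ fromCommutativeRing R
  ℤ⟶R = record
    { ⟦_⟧ = ⟦_⟧ℤ ; +-homo = ⟦+⟧ ; *-homo = ⟦*⟧ ; -‿homo = ⟦-⟧ ; 0-homo = refl ; 1-homo = refl }

  _≟ℤ_ : ∀ i j → Maybe (⟦ i ⟧ℤ ≈ ⟦ j ⟧ℤ)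
  i ≟ℤ j with i ℤ.≟ j
  ... | yes ≡.refl = just refl
  ... | no _       = nothing

  open import Algebra.Solver.Ring ℤ.+-*-rawRing (fromCommutativeRing R) ℤ⟶R _≟ℤ_ public

  :0 :1 : ∀ {k} → Polynomial k
  :0 = con (+ 0)
  :1 = con (+ 1)

private variable
  ℓ₁ : Level
  A B C : Set ℓ₁
  k : ℕ

infixl 6 _[_]≔_

_[_]≔_ : (Fin k → A) → Fin k → A → Fin k → A
(f [ p ]≔ x) i = if ⌊ p ≟ i ⌋ then x else f i

[]≔-updates : ∀ (f : Fin k → A) p {x} → (f [ p ]≔ x) p ≡ x
[]≔-updates f p with p ≟ p
... | yes _  = ≡.refl
... | no p≢p = ⊥-elim (p≢p ≡.refl)

[]≔-minimal : ∀ (f : Fin k → A) {p i x} → p ≢ i → (f [ p ]≔ x) i ≡ f i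
[]≔-minimal f {p} {i} p≢i with p ≟ i
... | yes p≡i = ⊥-elim (p≢i p≡i)
... | no _    = ≡.refl

[]≔-id : ∀ (f : Fin k → A) p → f [ p ]≔ f p ≗ f
[]≔-id f p i with p ≟ i
... | yes ≡.refl = ≡.refl
... | no _       = ≡.refl

[]≔-commutes : ∀ (f : Fin k → A) {p q} x y → p ≢ q → f [ p ]≔ x [ q ]≔ y ≗ f [ q ]≔ y [ p ]≔ x
[]≔-commutes f {p} {q} x y p≢q i with p ≟ i | q ≟ i
... | yes ≡.refl | yes ≡.refl = ⊥-elim (p≢q ≡.refl)
... | yes _      | no _       = ≡.refl
... | no _       | yes _      = ≡.refl
... | no _       | no _       = ≡.refl

[]≔-suc : ∀ (f : Fin (suc k) → A) p x → (f [ suc p ]≔ x) ∘ suc ≗ (f ∘ suc) [ p ]≔ x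
[]≔-suc f p x i = cong (λ t → if t then x else f (suc i)) (⌊⌋-map′ _ _ (p ≟ i))

[]≔-map : ∀ (h : Fin k → A → B) (f : Fin k → A) p x →
          (λ i → h i ((f [ p ]≔ x) i)) ≗ (λ i → h i (f i)) [ p ]≔ h p x
[]≔-map h f p x i with p ≟ i
... | yes ≡.refl = ≡.refl
... | no _       = ≡.refl

[]≔-map₂ : ∀ (h : Fin k → A → B → C) (f : Fin k → A) (g : Fin k → B) p x y →
           (λ i → h i ((f [ p ]≔ x) i) ((g [ p ]≔ y) i)) ≗ (λ i → h i (f i) (g i)) [ p ]≔ h p x y
[]≔-map₂ h f g p x y i with p ≟ i
... | yes ≡.refl = ≡.refl
... | no _       = ≡.refl

[]≔-if : ∀ (c : Fin k → Bool) (z w : Fin k → A) p q x y →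
         (λ i → if c i then (z [ p ]≔ x [ q ]≔ x) i else (w [ p ]≔ y [ q ]≔ y) i)
         ≗ (λ i → if c i then z i else w i) [ p ]≔ (if c p then x else y) [ q ]≔ (if c q then x else y)
[]≔-if c z w p q x y i with p ≟ i | q ≟ i
... | _          | yes ≡.refl = ≡.refl
... | yes ≡.refl | no _       = ≡.refl
... | no _       | no _       = ≡.refl

indicator : Fin k → Fin k → ℕ
indicator p = (λ _ → 0) [ p ]≔ 1

count : (Fin k → Bool) → ℕ
count {zero}  S = 0
count {suc k} S = if S zero then suc (count (S ∘ suc)) else count (S ∘ suc)

count-cong : ∀ {S T : Fin k → Bool} → S ≗ T → count S ≡ count T
count-cong {zero}  S≗T = ≡.refl
count-cong {suc k} {S} {T} S≗T
  rewrite S≗T zero | count-cong {S = S ∘ suc} {T = T ∘ suc} (S≗T ∘ suc) = ≡.refl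

count-true : ∀ k → count {k} (λ _ → true) ≡ k
count-true zero    = ≡.refl
count-true (suc k) = cong suc (count-true k)

count-[]≔-false : ∀ (S : Fin k → Bool) p → S p ≡ true → count S ≡ suc (count (S [ p ]≔ false))
count-[]≔-false S zero    Sp rewrite Sp = ≡.refl
count-[]≔-false S (suc p) Sp
  rewrite count-cong ([]≔-suc S p false) | count-[]≔-false (S ∘ suc) p Sp with S zero
... | true  = ≡.refl
... | false = ≡.refl

allFin-cong : ∀ k {p q : Fin k → Bool} → (∀ i → p i ≡ q i) → allFin k p ≡ allFin k q
allFin-cong zero    p≡q = ≡.refl
allFin-cong (suc k) p≡q = cong₂ _∧_ (p≡q zero) (allFin-cong k (λ i → p≡q (suc i)))

allFin-true : ∀ k → allFin k (λ _ → true) ≡ true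
allFin-true zero    = ≡.refl
allFin-true (suc k) = allFin-true k

allFin-∧ : ∀ k (p q : Fin k → Bool) → allFin k (λ i → p i ∧ q i) ≡ allFin k p ∧ allFin k q
allFin-∧ zero    p q = ≡.refl
allFin-∧ (suc k) p q =
  ≡.trans (cong ((p zero ∧ q zero) ∧_) (allFin-∧ k (p ∘ suc) (q ∘ suc))) (∧-interchange (p zero) (q zero) _ _)

allFin⇒ : ∀ k {p : Fin k → Bool} → allFin k p ≡ true → ∀ i → p i ≡ true
allFin⇒ (suc k) {p} all i with p zero in p0 | i
... | true | zero  = p0
... | true | suc i = allFin⇒ k all i

allFin-false⇒ : ∀ k {p : Fin k → Bool} → allFin k p ≡ false → ∃ λ i → p i ≡ false
allFin-false⇒ (suc k) {p} notAll with p zero in p0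
... | false = zero , p0
... | true  with allFin-false⇒ k notAll
...   | i , pi = suc i , pi

anyFin⇒ : ∀ k {p : Fin k → Bool} → anyFin k p ≡ true → ∃ λ i → p i ≡ true
anyFin⇒ (suc k) {p} some with p zero in p0
... | true  = zero , p0
... | false with anyFin⇒ k some
...   | i , pi = suc i , pi

anyFin-intro : ∀ k {p : Fin k → Bool} i → p i ≡ true → anyFin k p ≡ true
anyFin-intro (suc k) {p} zero    pi rewrite pi = ≡.refl
anyFin-intro (suc k) {p} (suc i) pi with p zero
... | true  = ≡.refl
... | false = anyFin-intro k i pi

anyFin-cong : ∀ k {p q : Fin k → Bool} → (∀ i → p i ≡ q i) → anyFin k p ≡ anyFin k q
anyFin-cong zero    p≡q = ≡.refl
anyFin-cong (suc k) p≡q = cong₂ _∨_ (p≡q zero) (anyFin-cong k (λ i → p≡q (suc i)))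

graph : ∀ {n m} → (Fin m → Fin n × Fin n) → Multigraph
graph {n} {m} ends = record { n = n ; m = m ; ends = ends }

module EdgeZero {n m : ℕ} (ends : Fin (suc m) → Fin n × Fin n) where

  G G∖0 : Multigraph
  G   = graph ends
  G∖0 = graph (ends ∘ suc)

  a b : Fin n
  a = proj₁ (ends zero)
  b = proj₂ (ends zero)

  loopFree disjoint avoids : Subset m → Bool
  loopFree D = allFin m (λ e → not (lookup D e) ∨ not (isLoop G∖0 e))
  disjoint D = allFin m (λ e → allFin m (λ e′ →
    not (lookup D e ∧ lookup D e′ ∧ not ⌊ e ≟ e′ ⌋) ∨ not (share G∖0 e e′)))
  avoids D = allFin m (λ e → not (lookup D e) ∨ not (share G zero (suc e)))

  private
    disjoint-suc : ∀ D e e′ →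
      (not (lookup D e ∧ lookup D e′ ∧ not ⌊ Fin.suc e ≟ suc e′ ⌋) ∨ not (share G (suc e) (suc e′)))
      ≡ (not (lookup D e ∧ lookup D e′ ∧ not ⌊ e ≟ e′ ⌋) ∨ not (share G∖0 e e′))
    disjoint-suc D e e′ =
      cong (λ t → not (lookup D e ∧ lookup D e′ ∧ not t) ∨ not (share G∖0 e e′)) (⌊⌋-map′ _ _ (e ≟ e′))

    rows : Subset m → Fin m → Bool
    rows D e = allFin m (λ e′ → not (lookup D e ∧ lookup D e′ ∧ not ⌊ Fin.suc e ≟ suc e′ ⌋)
                                ∨ not (share G (suc e) (suc e′)))

    rows-disjoint : ∀ D → allFin m (rows D) ≡ disjoint D
    rows-disjoint D = allFin-cong m (λ e → allFin-cong m (disjoint-suc D e))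

  share-sym : ∀ e e′ → share G e e′ ≡ share G e′ e
  share-sym e e′ = anyFin-cong n (λ i → ∧-comm (touches G i e) (touches G i e′))

  isMatching-outside : ∀ D → isMatching G (outside ∷ D) ≡ isMatching G∖0 D
  isMatching-outside D = cong (loopFree D ∧_) (begin
    allFin m (λ _ → true) ∧ allFin m (λ e → (not (lookup D e ∧ false) ∨ not (share G (suc e) zero)) ∧ rows D e)
      ≡⟨ cong₂ _∧_ (allFin-true m) (allFin-cong m (λ e → cong (λ t → (not t ∨ _) ∧ rows D e) (∧-zeroʳ (lookup D e)))) ⟩
    allFin m (rows D)
      ≡⟨ rows-disjoint D ⟩
    disjoint D ∎)
    where open ≡.≡-Reasoning

  isMatching-inside : ∀ D → isMatching G (inside ∷ D) ≡ not ⌊ a ≟ b ⌋ ∧ (isMatching G∖0 D ∧ avoids D)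
  isMatching-inside D = begin
    (not ⌊ a ≟ b ⌋ ∧ loopFree D) ∧ (allFin m avoidsˡ ∧ allFin m (λ e → avoidsʳ e ∧ rows D e))
      ≡⟨ cong ((not ⌊ a ≟ b ⌋ ∧ loopFree D) ∧_) (cong₂ _∧_
           (allFin-cong m (λ e → cong (λ t → not t ∨ not (share G zero (suc e))) (∧-identityʳ (lookup D e))))
           (allFin-∧ m avoidsʳ (rows D))) ⟩
    (not ⌊ a ≟ b ⌋ ∧ loopFree D) ∧ (avoids D ∧ (allFin m avoidsʳ ∧ allFin m (rows D)))
      ≡⟨ cong (λ t → (not ⌊ a ≟ b ⌋ ∧ loopFree D) ∧ (avoids D ∧ t)) (cong₂ _∧_
           (allFin-cong m (λ e → cong₂ (λ s t → not s ∨ not t) (∧-identityʳ (lookup D e)) (share-sym (suc e) zero)))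
           (rows-disjoint D)) ⟩
    (not ⌊ a ≟ b ⌋ ∧ loopFree D) ∧ (avoids D ∧ (avoids D ∧ disjoint D))
      ≡⟨ rearrange (not ⌊ a ≟ b ⌋) (loopFree D) (avoids D) (disjoint D) ⟩
    not ⌊ a ≟ b ⌋ ∧ ((loopFree D ∧ disjoint D) ∧ avoids D) ∎
    where
    open ≡.≡-Reasoning
    avoidsˡ avoidsʳ : Fin m → Bool
    avoidsˡ e = not (lookup D e ∧ true) ∨ not (share G zero (suc e))
    avoidsʳ e = not (lookup D e ∧ true) ∨ not (share G (suc e) zero)
    rearrange : ∀ l f x d → (l ∧ f) ∧ (x ∧ (x ∧ d)) ≡ l ∧ ((f ∧ d) ∧ x)
    rearrange l f x d = prove 4 ((L ∙ F) ∙ (X ∙ (X ∙ Dj))) (L ∙ ((F ∙ Dj) ∙ X)) (l ∷ f ∷ x ∷ d ∷ [])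
      where
      open ICM ∧-idempotentCommutativeMonoid using (prove; var) renaming (_⊕_ to _∙_)
      L = var zero
      F = var (suc zero)
      X = var (suc (suc zero))
      Dj = var (suc (suc (suc zero)))

  avoids⇒uncovered : ∀ D {i} → avoids D ≡ true → touches G i zero ≡ true → covered G∖0 D i ≡ false
  avoids⇒uncovered D {i} avoids-D touches-i with covered G∖0 D i in covered-i
  ... | false = ≡.refl
  ... | true with anyFin⇒ m covered-i
  ...   | e , e∈D∧touches with ≡.subst₂ (λ x y → not x ∨ not y ≡ true) e∈D shares (allFin⇒ m avoids-D e)
    where
    e∈D : lookup D e ≡ true
    e∈D = ∧-conicalˡ (lookup D e) (touches G i (suc e)) e∈D∧touches
    shares : share G zero (suc e) ≡ true
    shares = anyFin-intro n i (cong₂ _∧_ touches-i (∧-conicalʳ (lookup D e) _ e∈D∧touches))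
  ...     | ()

  ¬avoids⇒covered : ∀ D → avoids D ≡ false → ∃ λ i → touches G i zero ≡ true × covered G∖0 D i ≡ true
  ¬avoids⇒covered D ¬avoids-D with allFin-false⇒ m ¬avoids-D
  ... | e , ¬avoids-e with anyFin⇒ n (not-injective (∨-conicalʳ (not (lookup D e)) _ ¬avoids-e))
  ...   | i , touches-i-0∧e =
    i , ∧-conicalˡ (touches G i zero) _ touches-i-0∧e
      , anyFin-intro m e (cong₂ _∧_ (not-injective (∨-conicalˡ _ (not (share G zero (suc e))) ¬avoids-e))
                                    (∧-conicalʳ (touches G i zero) _ touches-i-0∧e))

  touches-a : touches G a zero ≡ true
  touches-a rewrite ≡-≟-identity _≟_ {a} ≡.refl = ≡.refl

  touches-b : touches G b zero ≡ true
  touches-b rewrite ≡-≟-identity _≟_ {b} ≡.refl = ∨-zeroʳ _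

  touches-[]≔ : ∀ (c : Fin n → Bool) (z w : Fin n → A) →
                (λ i → if touches G i zero ∨ c i then z i else w i)
                ≗ (λ i → if c i then z i else w i) [ a ]≔ z a [ b ]≔ z b
  touches-[]≔ c z w i with a ≟ i | b ≟ i
  ... | yes ≡.refl | no _     = ≡.refl
  ... | yes _      | yes b≡i = cong z (≡.sym b≡i)
  ... | no _       | yes b≡i = cong z (≡.sym b≡i)
  ... | no _       | no _     = ≡.refl

  touched-[]≔ : ∀ (f : Fin n → A) x {i} → touches G i zero ≡ true → (f [ a ]≔ x [ b ]≔ x) i ≡ x
  touched-[]≔ f x {i} touches-i with a ≟ i | b ≟ i
  ... | _     | yes _ = ≡.refl
  ... | yes _ | no _  = ≡.refl
  ... | no _  | no _  with () ← touches-i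

module RingLemmas {c ℓ : Level} (R : CommutativeRing c ℓ) where
  open CommutativeRing R hiding (zero)
  open Ring R
  open import Relation.Binary.Reasoning.Setoid setoid
  open import Algebra.Properties.CommutativeSemigroup *-commutativeSemigroup
    using (x∙yz≈y∙xz) renaming (interchange to *-interchange)
  open import Algebra.Properties.CommutativeSemigroup +-commutativeSemigroup
    using () renaming (interchange to +-interchange)

  χ : Bool → Carrier
  χ true  = 1#
  χ false = 0#

  χ-guard : ∀ σ {x y} → (σ ≡ true → x ≈ y) → χ σ * x ≈ χ σ * y
  χ-guard true  x≈y = *-congˡ (x≈y ≡.refl)
  χ-guard false _   = trans (zeroˡ _) (sym (zeroˡ _))

  pow-+ : ∀ x j k → pow x (j ℕ.+ k) ≈ pow x j * pow x k
  pow-+ x zero    k = sym (*-identityˡ _)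
  pow-+ x (suc j) k = trans (*-congˡ (pow-+ x j k)) (sym (*-assoc _ _ _))

  pow-inverse : ∀ {x y} k → x * y ≈ 1# → pow x k * pow y k ≈ 1#
  pow-inverse         zero    xy≈1 = *-identityˡ 1#
  pow-inverse {x} {y} (suc k) xy≈1 = begin
    (x * pow x k) * (y * pow y k)   ≈⟨ *-interchange x (pow x k) y (pow y k) ⟩
    (x * y) * (pow x k * pow y k)   ≈⟨ *-cong xy≈1 (pow-inverse k xy≈1) ⟩
    1# * 1#                         ≈⟨ *-identityˡ 1# ⟩
    1#                              ∎

  prodR-cong : ∀ k {f g : Fin k → Carrier} → (∀ i → f i ≈ g i) → prodR k f ≈ prodR k g
  prodR-cong zero    f≈g = refl
  prodR-cong (suc k) f≈g = *-cong (f≈g zero) (prodR-cong k (f≈g ∘ suc))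

  prodR-[]≔ : ∀ k (f : Fin k → Carrier) p x → prodR k (f [ p ]≔ x) ≈ x * prodR k (f [ p ]≔ 1#)
  prodR-[]≔ (suc k) f zero    x = *-congˡ (sym (*-identityˡ _))
  prodR-[]≔ (suc k) f (suc p) x = begin
    f zero * prodR k ((f [ suc p ]≔ x) ∘ suc)        ≈⟨ *-congˡ (prodR-cong k (reflexive ∘ []≔-suc f p x)) ⟩
    f zero * prodR k ((f ∘ suc) [ p ]≔ x)            ≈⟨ *-congˡ (prodR-[]≔ k (f ∘ suc) p x) ⟩
    f zero * (x * prodR k ((f ∘ suc) [ p ]≔ 1#))     ≈⟨ x∙yz≈y∙xz _ _ _ ⟩
    x * (f zero * prodR k ((f ∘ suc) [ p ]≔ 1#))     ≈⟨ *-congˡ (*-congˡ (prodR-cong k (reflexive ∘ []≔-suc f p 1#))) ⟨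
    x * (f zero * prodR k ((f [ suc p ]≔ 1#) ∘ suc)) ∎

  prodR-pick : ∀ k (f : Fin k → Carrier) p → prodR k f ≈ f p * prodR k (f [ p ]≔ 1#)
  prodR-pick k f p = trans (prodR-cong k (sym ∘ reflexive ∘ []≔-id f p)) (prodR-[]≔ k f p (f p))

  prodR-zero : ∀ k (f : Fin k → Carrier) p → f p ≈ 0# → prodR k f ≈ 0#
  prodR-zero k f p fp≈0 = trans (prodR-pick k f p) (trans (*-congʳ fp≈0) (zeroˡ _))

  prodR-ones : ∀ k {f : Fin k → Carrier} → (∀ i → f i ≈ 1#) → prodR k f ≈ 1#
  prodR-ones zero    f≈1 = refl
  prodR-ones (suc k) f≈1 = trans (*-cong (f≈1 zero) (prodR-ones k (f≈1 ∘ suc))) (*-identityˡ 1#)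

  prodR-count : ∀ k (S : Fin k → Bool) x → prodR k (λ i → if S i then x else 1#) ≈ pow x (count S)
  prodR-count zero    S x = refl
  prodR-count (suc k) S x with S zero
  ... | true  = *-congˡ (prodR-count k (S ∘ suc) x)
  ... | false = trans (*-identityˡ _) (prodR-count k (S ∘ suc) x)

  sumSub-cong : ∀ k {f g : Subset k → Carrier} → (∀ s → f s ≈ g s) → sumSub k f ≈ sumSub k g
  sumSub-cong zero    f≈g = f≈g []
  sumSub-cong (suc k) f≈g = +-cong (sumSub-cong k (f≈g ∘ (outside ∷_))) (sumSub-cong k (f≈g ∘ (inside ∷_)))

  sumSub-zero : ∀ k → sumSub k (λ _ → 0#) ≈ 0#
  sumSub-zero zero    = refl
  sumSub-zero (suc k) = trans (+-cong (sumSub-zero k) (sumSub-zero k)) (+-identityˡ 0#)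

  sumSub-+ : ∀ k (f g : Subset k → Carrier) → sumSub k (λ s → f s + g s) ≈ sumSub k f + sumSub k g
  sumSub-+ zero    f g = refl
  sumSub-+ (suc k) f g = trans (+-cong (sumSub-+ k _ _) (sumSub-+ k _ _)) (+-interchange _ _ _ _)

  sumSub-* : ∀ k x (f : Subset k → Carrier) → sumSub k (λ s → x * f s) ≈ x * sumSub k f
  sumSub-* zero    x f = refl
  sumSub-* (suc k) x f = trans (+-cong (sumSub-* k x _) (sumSub-* k x _)) (sym (distribˡ x _ _))

  sumSub-affine : ∀ k {f g h : Subset k → Carrier} {x} → (∀ s → f s ≈ g s + x * h s) →
                  sumSub k f ≈ sumSub k g + x * sumSub k h
  sumSub-affine k {g = g} {h} {x} f≈ =
    trans (sumSub-cong k f≈) (trans (sumSub-+ k g _) (+-congˡ (sumSub-* k x h)))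

module Matchings {c ℓ : Level} (R : CommutativeRing c ℓ) where
  open CommutativeRing R hiding (zero)
  open Ring R
  open RingLemmas R
  open ℤ-Solver R using (solve; _:+_; _:*_; _:=_; :0; :1)
  open import Algebra.Properties.CommutativeSemigroup *-commutativeSemigroup using (x∙yz≈y∙xz)
  open import Relation.Binary.Reasoning.Setoid setoid

  module _ (G : Multigraph) (μ : Carrier) where
    open Multigraph G

    matchingWeight : (w z : Fin n → Carrier) → Subset m → Carrier
    matchingWeight w z D = pow μ ∣ D ∣ * prodR n (λ i → if covered G D i then z i else w i)

    ℳ : (w z : Fin n → Carrier) → Carrier
    ℳ w z = sumSub m (λ D → if isMatching G D then matchingWeight w z D else 0#)

    ℳ-cong : ∀ {w w′ z z′} → (∀ i → w i ≈ w′ i) → (∀ i → z i ≈ z′ i) → ℳ w z ≈ ℳ w′ z′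
    ℳ-cong w≈w′ z≈z′ = sumSub-cong m λ D → if-cong (isMatching G D)
      (*-congˡ (prodR-cong n λ i → if-cong₂ (covered G D i) (z≈z′ i) (w≈w′ i)))
      where
      if-cong : ∀ b {x y} → x ≈ y → (if b then x else 0#) ≈ (if b then y else 0#)
      if-cong true  x≈y = x≈y
      if-cong false _   = refl
      if-cong₂ : ∀ b {x x′ y y′} → x ≈ x′ → y ≈ y′ → (if b then x else y) ≈ (if b then x′ else y′)
      if-cong₂ true  x≈x′ _ = x≈x′
      if-cong₂ false _ y≈y′ = y≈y′

    ℳ-split : ∀ w z p x y → ℳ (w [ p ]≔ (x + y)) z ≈ ℳ (w [ p ]≔ x) z + y * ℳ (w [ p ]≔ 1#) (z [ p ]≔ 0#)
    ℳ-split w z p x y = sumSub-affine m λ D → on-matchings (isMatching G D) (split-at D)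
      where
      on-matchings : ∀ b {t t₁ t₂} → t ≈ t₁ + y * t₂ →
                     (if b then t else 0#) ≈ (if b then t₁ else 0#) + y * (if b then t₂ else 0#)
      on-matchings true  t≈ = t≈
      on-matchings false _  = sym (trans (+-identityˡ _) (zeroʳ y))
      split-at : ∀ D → matchingWeight (w [ p ]≔ (x + y)) z D
                       ≈ matchingWeight (w [ p ]≔ x) z D + y * matchingWeight (w [ p ]≔ 1#) (z [ p ]≔ 0#) D
      split-at D = begin
        pow μ ∣ D ∣ * prodR n (λ i → if cov i then z i else (w [ p ]≔ (x + y)) i)
          ≈⟨ *-congˡ (at-p (x + y)) ⟩
        pow μ ∣ D ∣ * ((if cov p then z p else x + y) * rest)
          ≈⟨ scalar (cov p) ⟩
        pow μ ∣ D ∣ * ((if cov p then z p else x) * rest) + y * (pow μ ∣ D ∣ * ((if cov p then 0# else 1#) * rest))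
          ≈⟨ +-cong (*-congˡ (at-p x)) (*-congˡ (*-congˡ (begin
               prodR n (λ i → if cov i then (z [ p ]≔ 0#) i else (w [ p ]≔ 1#) i)
                 ≈⟨ prodR-cong n (reflexive ∘ []≔-map₂ (λ i u v → if cov i then v else u) w z p 1# 0#) ⟩
               prodR n (g [ p ]≔ (if cov p then 0# else 1#))
                 ≈⟨ prodR-[]≔ n g p _ ⟩
               (if cov p then 0# else 1#) * rest ∎))) ⟨
        matchingWeight (w [ p ]≔ x) z D + y * matchingWeight (w [ p ]≔ 1#) (z [ p ]≔ 0#) D ∎
        where
        cov = covered G D
        g : Fin n → Carrier
        g i = if cov i then z i else w i
        rest = prodR n (g [ p ]≔ 1#)
        at-p : ∀ v → prodR n (λ i → if cov i then z i else (w [ p ]≔ v) i) ≈ (if cov p then z p else v) * rest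
        at-p v = trans (prodR-cong n (reflexive ∘ []≔-map (λ i u → if cov i then z i else u) w p v))
                       (prodR-[]≔ n g p _)
        scalar : ∀ b → pow μ ∣ D ∣ * ((if b then z p else x + y) * rest)
                       ≈ pow μ ∣ D ∣ * ((if b then z p else x) * rest) + y * (pow μ ∣ D ∣ * ((if b then 0# else 1#) * rest))
        scalar true  = solve 4 (λ P Z Y Rs → P :* (Z :* Rs) := P :* (Z :* Rs) :+ Y :* (P :* (:0 :* Rs))) refl
                         (pow μ ∣ D ∣) (z p) y rest
        scalar false = solve 4 (λ P X Y Rs → P :* ((X :+ Y) :* Rs) := P :* (X :* Rs) :+ Y :* (P :* (:1 :* Rs))) refl
                         (pow μ ∣ D ∣) x y rest

  module _ {n m : ℕ} (ends : Fin (suc m) → Fin n × Fin n) (μ : Carrier) where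
    open EdgeZero ends

    private
      outside-terms : ∀ w z →
        sumSub m (λ D → if isMatching G (outside ∷ D) then matchingWeight G μ w z (outside ∷ D) else 0#)
        ≈ ℳ G∖0 μ w z
      outside-terms w z = sumSub-cong m λ D →
        reflexive (cong (λ t → if t then matchingWeight G∖0 μ w z D else 0#) (isMatching-outside D))

    ℳ-delete-loop : a ≡ b → ∀ w z → ℳ G μ w z ≈ ℳ G∖0 μ w z
    ℳ-delete-loop a≡b w z =
      trans (+-cong (outside-terms w z) (trans (sumSub-cong m no-matching) (sumSub-zero m))) (+-identityʳ _)
      where
      no-matching : ∀ D → (if isMatching G (inside ∷ D) then matchingWeight G μ w z (inside ∷ D) else 0#) ≈ 0#
      no-matching D rewrite isMatching-inside D | ≡-≟-identity _≟_ a≡b = refl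

    ℳ-delete-edge : a ≢ b → ∀ w z →
      ℳ G μ w z ≈ ℳ G∖0 μ w z + μ * z a * z b * ℳ G∖0 μ (w [ a ]≔ 1# [ b ]≔ 1#) (z [ a ]≔ 0# [ b ]≔ 0#)
    ℳ-delete-edge a≢b w z = +-cong (outside-terms w z) (trans (sumSub-cong m inside-term) (sumSub-* m _ _))
      where
      W Z : Fin n → Carrier
      W = w [ a ]≔ 1# [ b ]≔ 1#
      Z = z [ a ]≔ 0# [ b ]≔ 0#
      two-points : ∀ g x y → prodR n (g [ a ]≔ x [ b ]≔ y) ≈ x * (y * prodR n (g [ a ]≔ 1# [ b ]≔ 1#))
      two-points g x y = begin
        prodR n (g [ a ]≔ x [ b ]≔ y)              ≈⟨ prodR-[]≔ n _ b y ⟩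
        y * prodR n (g [ a ]≔ x [ b ]≔ 1#)         ≈⟨ *-congˡ (prodR-cong n (reflexive ∘ []≔-commutes g x 1# a≢b)) ⟩
        y * prodR n (g [ b ]≔ 1# [ a ]≔ x)         ≈⟨ *-congˡ (prodR-[]≔ n _ a x) ⟩
        y * (x * prodR n (g [ b ]≔ 1# [ a ]≔ 1#))  ≈⟨ *-congˡ (*-congˡ (prodR-cong n (reflexive ∘ []≔-commutes g 1# 1# a≢b))) ⟨
        y * (x * prodR n (g [ a ]≔ 1# [ b ]≔ 1#))  ≈⟨ x∙yz≈y∙xz y x _ ⟩
        x * (y * prodR n (g [ a ]≔ 1# [ b ]≔ 1#))  ∎
      inside-term : ∀ D → (if isMatching G (inside ∷ D) then matchingWeight G μ w z (inside ∷ D) else 0#)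
                          ≈ μ * z a * z b * (if isMatching G∖0 D then matchingWeight G∖0 μ W Z D else 0#)
      inside-term D rewrite isMatching-inside D | ≢-≟-identity _≟_ a≢b
        with isMatching G∖0 D | avoids D in avoids-D
      ... | false | _     = sym (zeroʳ _)
      ... | true  | true  = begin
        μ * pow μ ∣ D ∣ * prodR n (λ i → if touches G i zero ∨ cov i then z i else w i)
          ≈⟨ *-congˡ (trans (prodR-cong n (reflexive ∘ touches-[]≔ cov z w)) (two-points g (z a) (z b))) ⟩
        μ * pow μ ∣ D ∣ * (z a * (z b * rest))
          ≈⟨ solve 5 (λ M P A B Rs → M :* P :* (A :* (B :* Rs)) := M :* A :* B :* (P :* Rs)) refl
                     μ (pow μ ∣ D ∣) (z a) (z b) rest ⟩
        μ * z a * z b * (pow μ ∣ D ∣ * rest)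
          ≈⟨ *-congˡ (*-congˡ (prodR-cong n (reflexive ∘ ends-uncovered))) ⟨
        μ * z a * z b * matchingWeight G∖0 μ W Z D ∎
        where
        cov = covered G∖0 D
        g : Fin n → Carrier
        g i = if cov i then z i else w i
        rest = prodR n (g [ a ]≔ 1# [ b ]≔ 1#)
        ends-uncovered : (λ i → if cov i then Z i else W i) ≗ g [ a ]≔ 1# [ b ]≔ 1#
        ends-uncovered i = ≡.trans ([]≔-if cov z w a b 0# 1# i)
          (cong₂ (λ s t → (g [ a ]≔ (if s then 0# else 1#) [ b ]≔ (if t then 0# else 1#)) i)
                 (avoids⇒uncovered D avoids-D touches-a) (avoids⇒uncovered D avoids-D touches-b))
      ... | true  | false with ¬avoids⇒covered D avoids-D
      ...   | i , touches-i , covered-i = sym (begin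
        μ * z a * z b * (pow μ ∣ D ∣ * prodR n (λ j → if covered G∖0 D j then Z j else W j))
          ≈⟨ *-congˡ (*-congˡ (prodR-zero n _ i (reflexive factor-i))) ⟩
        μ * z a * z b * (pow μ ∣ D ∣ * 0#)
          ≈⟨ trans (*-congˡ (zeroʳ _)) (zeroʳ _) ⟩
        0# ∎)
        where
        factor-i : (if covered G∖0 D i then Z i else W i) ≡ 0#
        factor-i = ≡.trans (cong (λ t → if t then Z i else W i) covered-i) (touched-[]≔ z 0# touches-i)

-- In Ξ⁺ G δ S the vertices outside S are inactive; an active vertex has weight λ of its degree raised by δ.
module XiSide {c ℓ : Level} (R : CommutativeRing c ℓ) (β : CommutativeRing.Carrier R) where
  open CommutativeRing R hiding (zero)
  open Ring R
  open RingLemmas R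
  open Matchings R
  open ℤ-Solver R using (solve; _:+_; _:*_; _:-_; :-_; _:=_; :0; :1)
  open import Relation.Binary.Reasoning.Setoid setoid

  lamDeg : ℕ → Carrier
  lamDeg d = 1# + (fromℕ d - 1#) * β

  Ξ⁺ : (G : Multigraph) → (Fin (Multigraph.n G) → ℕ) → (Fin (Multigraph.n G) → Bool) → Carrier
  Ξ⁺ G δ S = ℳ G (- β) (λ i → if S i then lamDeg (δ i ℕ.+ deg G i) else 1#) (λ i → χ (S i))

  Ξ : (G : Multigraph) → (Fin (Multigraph.n G) → Bool) → Carrier
  Ξ G = Ξ⁺ G (λ _ → 0)

  Ξ⁺-cong : ∀ G {δ δ′} S → δ ≗ δ′ → Ξ⁺ G δ S ≈ Ξ⁺ G δ′ S
  Ξ⁺-cong G S δ≗δ′ =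
    ℳ-cong G (- β) (λ i → reflexive (cong (λ d → if S i then lamDeg (d ℕ.+ deg G i) else 1#) (δ≗δ′ i))) (λ _ → refl)

  Ξ⁺-bump : ∀ G δ S p → Ξ⁺ G (λ i → indicator p i ℕ.+ δ i) S ≈ Ξ⁺ G δ S + β * (χ (S p) * Ξ⁺ G δ (S [ p ]≔ false))
  Ξ⁺-bump G δ S p = begin
    ℳ G (- β) (λ i → if S i then lamDeg (indicator p i ℕ.+ δ i ℕ.+ deg G i) else 1#) z
      ≈⟨ ℳ-cong G (- β) bumped (λ _ → refl) ⟩
    ℳ G (- β) (w [ p ]≔ (w p + β * χ (S p))) z
      ≈⟨ ℳ-split G (- β) w z p (w p) (β * χ (S p)) ⟩
    ℳ G (- β) (w [ p ]≔ w p) z + β * χ (S p) * ℳ G (- β) (w [ p ]≔ 1#) (z [ p ]≔ 0#)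
      ≈⟨ +-cong (ℳ-cong G (- β) (reflexive ∘ []≔-id w p) (λ _ → refl))
                (*-congˡ (ℳ-cong G (- β) (reflexive ∘ ≡.sym ∘ []≔-map (λ i σ → if σ then lamDeg (δ i ℕ.+ deg G i) else 1#) S p false)
                                         (reflexive ∘ ≡.sym ∘ []≔-map (λ _ → χ) S p false))) ⟩
    Ξ⁺ G δ S + β * χ (S p) * Ξ⁺ G δ (S [ p ]≔ false)
      ≈⟨ +-congˡ (*-assoc _ _ _) ⟩
    Ξ⁺ G δ S + β * (χ (S p) * Ξ⁺ G δ (S [ p ]≔ false)) ∎
    where
    open Multigraph G
    w z : Fin n → Carrier
    w i = if S i then lamDeg (δ i ℕ.+ deg G i) else 1#
    z i = χ (S i)
    lamDeg-suc : ∀ σ d → (if σ then lamDeg (suc d) else 1#) ≈ (if σ then lamDeg d else 1#) + β * χ σ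
    lamDeg-suc true  d = solve 2 (λ F B → :1 :+ ((:1 :+ F) :- :1) :* B
                                          := :1 :+ (F :- :1) :* B :+ B :* :1) refl (fromℕ d) β
    lamDeg-suc false d = solve 1 (λ B → :1 := :1 :+ B :* :0) refl β
    bumped : ∀ i → (if S i then lamDeg (indicator p i ℕ.+ δ i ℕ.+ deg G i) else 1#) ≈ (w [ p ]≔ (w p + β * χ (S p))) i
    bumped i with p ≟ i
    ... | yes ≡.refl = lamDeg-suc (S p) (δ p ℕ.+ deg G p)
    ... | no _       = refl

  Ξ-edgeless : ∀ {n} (ends : Fin 0 → Fin n × Fin n) S → Ξ (graph ends) S ≈ pow (1# - β) (count S)
  Ξ-edgeless {n} ends S = trans (*-identityˡ _) (trans (prodR-cong n (lamDeg-0 ∘ S)) (prodR-count n S _))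
    where
    lamDeg-0 : ∀ σ → (if σ then lamDeg 0 else 1#) ≈ (if σ then 1# - β else 1#)
    lamDeg-0 true  = solve 1 (λ B → :1 :+ (:0 :- :1) :* B := :1 :- B) refl β
    lamDeg-0 false = refl

  module _ {n m : ℕ} (ends : Fin (suc m) → Fin n × Fin n) where
    open EdgeZero ends

    -- The factor χ ((S [ a ]≔ false) b), rather than χ (S b), vanishes when edge zero is a loop.
    Ξ-delete : ∀ S → Ξ G S ≈ Ξ⁺ G∖0 (λ i → incid G i zero) S
                             + - β * χ (S a) * χ ((S [ a ]≔ false) b) * Ξ G∖0 (S [ a ]≔ false [ b ]≔ false)
    Ξ-delete S = by-cases (a ≟ b)
      where
      w z : Fin n → Carrier
      w i = if S i then lamDeg (deg G i) else 1#
      z i = χ (S i)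
      Sab = S [ a ]≔ false [ b ]≔ false
      inactive-ends-w : ∀ i → (w [ a ]≔ 1# [ b ]≔ 1#) i ≈ (if Sab i then lamDeg (deg G∖0 i) else 1#)
      inactive-ends-w i with a ≟ i | b ≟ i
      ... | _          | yes ≡.refl = refl
      ... | yes ≡.refl | no _       = refl
      ... | no _       | no _       = refl
      inactive-ends-z : ∀ i → (z [ a ]≔ 0# [ b ]≔ 0#) i ≈ χ (Sab i)
      inactive-ends-z i with a ≟ i | b ≟ i
      ... | _          | yes ≡.refl = refl
      ... | yes ≡.refl | no _       = refl
      ... | no _       | no _       = refl
      by-cases : Dec (a ≡ b) →
        Ξ G S ≈ Ξ⁺ G∖0 (λ i → incid G i zero) S + - β * χ (S a) * χ ((S [ a ]≔ false) b) * Ξ G∖0 Sab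
      by-cases (yes a≡b) = begin
        ℳ G (- β) w z
          ≈⟨ ℳ-delete-loop ends (- β) a≡b w z ⟩
        Ξ⁺ G∖0 (λ i → incid G i zero) S
          ≈⟨ solve 4 (λ X B A Y → X := X :+ (:- B) :* A :* :0 :* Y) refl _ β (χ (S a)) _ ⟩
        Ξ⁺ G∖0 (λ i → incid G i zero) S + - β * χ (S a) * χ false * Ξ G∖0 Sab
          ≡⟨ cong (λ σ → Ξ⁺ G∖0 (λ i → incid G i zero) S + - β * χ (S a) * χ σ * Ξ G∖0 Sab) (≡.sym Sa-b≡false) ⟩
        Ξ⁺ G∖0 (λ i → incid G i zero) S + - β * χ (S a) * χ ((S [ a ]≔ false) b) * Ξ G∖0 Sab ∎
        where
        Sa-b≡false : (S [ a ]≔ false) b ≡ false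
        Sa-b≡false = ≡.subst (λ x → (S [ a ]≔ false) x ≡ false) a≡b ([]≔-updates S a)
      by-cases (no a≢b) = begin
        ℳ G (- β) w z
          ≈⟨ ℳ-delete-edge ends (- β) a≢b w z ⟩
        Ξ⁺ G∖0 (λ i → incid G i zero) S + - β * z a * z b * ℳ G∖0 (- β) (w [ a ]≔ 1# [ b ]≔ 1#) (z [ a ]≔ 0# [ b ]≔ 0#)
          ≈⟨ +-congˡ (*-cong (*-congˡ (reflexive (cong χ (≡.sym ([]≔-minimal S a≢b)))))
                              (ℳ-cong G∖0 (- β) inactive-ends-w inactive-ends-z)) ⟩
        Ξ⁺ G∖0 (λ i → incid G i zero) S + - β * χ (S a) * χ ((S [ a ]≔ false) b) * Ξ G∖0 Sab ∎

    -- incid G i zero unfolds to indicator a i + indicator b i: one bump at a, one at b.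
    Ξ-recurrence : ∀ S → let Sa = S [ a ]≔ false in
      Ξ G S ≈ Ξ G∖0 S + β * χ (S a) * Ξ G∖0 Sa + β * χ (S b) * Ξ G∖0 (S [ b ]≔ false)
              - β * (1# - β) * χ (S a) * χ (Sa b) * Ξ G∖0 (Sa [ b ]≔ false)
    Ξ-recurrence S = begin
      Ξ G S
        ≈⟨ Ξ-delete S ⟩
      Ξ⁺ G∖0 (λ i → indicator a i ℕ.+ indicator b i) S + - β * χ (S a) * χ (Sa b) * Ξ G∖0 Sab
        ≈⟨ +-congʳ (trans (Ξ⁺-bump G∖0 (indicator b) S a) (+-cong (bump-b S) (*-congˡ (*-congˡ (bump-b Sa))))) ⟩
      Ξ G∖0 S + β * (χ (S b) * Ξ G∖0 Sb) + β * (χ (S a) * (Ξ G∖0 Sa + β * (χ (Sa b) * Ξ G∖0 Sab)))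
        + - β * χ (S a) * χ (Sa b) * Ξ G∖0 Sab
        ≈⟨ solve 8 (λ B A Bb C X Xa Xb Xab →
               X :+ B :* (Bb :* Xb) :+ B :* (A :* (Xa :+ B :* (C :* Xab))) :+ (:- B) :* A :* C :* Xab
               := X :+ B :* A :* Xa :+ B :* Bb :* Xb :- B :* (:1 :- B) :* A :* C :* Xab)
             refl β (χ (S a)) (χ (S b)) (χ (Sa b)) (Ξ G∖0 S) (Ξ G∖0 Sa) (Ξ G∖0 Sb) (Ξ G∖0 Sab) ⟩
      Ξ G∖0 S + β * χ (S a) * Ξ G∖0 Sa + β * χ (S b) * Ξ G∖0 Sb - β * (1# - β) * χ (S a) * χ (Sa b) * Ξ G∖0 Sab ∎
      where
      Sa = S [ a ]≔ false
      Sb = S [ b ]≔ false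
      Sab = Sa [ b ]≔ false
      bump-b : ∀ T → Ξ⁺ G∖0 (indicator b) T ≈ Ξ G∖0 T + β * (χ (T b) * Ξ G∖0 (T [ b ]≔ false))
      bump-b T = trans (Ξ⁺-cong G∖0 T (λ i → ≡.sym (ℕ.+-identityʳ (indicator b i)))) (Ξ⁺-bump G∖0 (λ _ → 0) T b)

-- In θ⁺ G δ S a vertex i outside S contributes ι^{d_i(s)} instead of f_{d_i(s)}(2ι); δ raises degrees.
module ThetaSide {c ℓ : Level} (R : CommutativeRing c ℓ) (ι β : CommutativeRing.Carrier R)
                 (ι²≈-1 : CommutativeRing._≈_ R (CommutativeRing._*_ R ι ι) (CommutativeRing.-_ R (CommutativeRing.1# R)))
                 where
  open CommutativeRing R hiding (zero)
  open Ring R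
  open RingLemmas R
  open ℤ-Solver R using (solve; _:+_; _:*_; _:-_; :-_; _:=_; :0; :1)
  open import Relation.Binary.Reasoning.Setoid setoid

  φ : Bool → ℕ → Carrier
  φ true  d = fpoly d (ι + ι)
  φ false d = pow ι d

  cancel-ι²+1 : ∀ {x y} k → x ≈ y + (ι * ι + 1#) * k → x ≈ y
  cancel-ι²+1 {x} {y} k x≈ = begin
    x                         ≈⟨ x≈ ⟩
    y + (ι * ι + 1#) * k      ≈⟨ +-congˡ (*-congʳ (trans (+-congʳ ι²≈-1) (-‿inverseˡ 1#))) ⟩
    y + 0# * k                ≈⟨ +-congˡ (zeroˡ k) ⟩
    y + 0#                    ≈⟨ +-identityʳ y ⟩
    y                         ∎

  φ-suc : ∀ σ d → φ σ (suc d) ≈ ι * (φ σ d - χ σ * φ false d)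
  φ-suc false d = solve 2 (λ I P → I :* P := I :* (P :- :0 :* P)) refl ι (pow ι d)
  φ-suc true zero = solve 1 (λ I → :0 := I :* (:1 :- :1 :* :1)) refl ι
  φ-suc true (suc d) = cancel-ι²+1 (φ true d) (begin
    (ι + ι) * φ true (suc d) + φ true d
      ≈⟨ +-congʳ (*-congˡ (φ-suc true d)) ⟩
    (ι + ι) * (ι * (φ true d - 1# * pow ι d)) + φ true d
      ≈⟨ solve 3 (λ I F P → (I :+ I) :* (I :* (F :- :1 :* P)) :+ F
                            := I :* (I :* (F :- :1 :* P) :- :1 :* (I :* P)) :+ (I :* I :+ :1) :* F)
               refl ι (φ true d) (pow ι d) ⟩
    ι * (ι * (φ true d - 1# * pow ι d) - 1# * (ι * pow ι d)) + (ι * ι + 1#) * φ true d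
      ≈⟨ +-congʳ (*-congˡ (+-congʳ (φ-suc true d))) ⟨
    ι * (φ true (suc d) - 1# * φ false (suc d)) + (ι * ι + 1#) * φ true d ∎)

  θ⁺ : (G : Multigraph) → (Fin (Multigraph.n G) → ℕ) → (Fin (Multigraph.n G) → Bool) → Carrier
  θ⁺ G δ S = sumSub m (λ s → pow β ∣ s ∣ * prodR n (λ i → φ (S i) (δ i ℕ.+ degIn G s i)))
    where open Multigraph G

  θ : (G : Multigraph) → (Fin (Multigraph.n G) → Bool) → Carrier
  θ G = θ⁺ G (λ _ → 0)

  θ⁺-cong : ∀ G {δ δ′} S → δ ≗ δ′ → θ⁺ G δ S ≈ θ⁺ G δ′ S
  θ⁺-cong G S δ≗δ′ = sumSub-cong m λ s → *-congˡ (prodR-cong n λ i →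
    reflexive (cong (λ d → φ (S i) (d ℕ.+ degIn G s i)) (δ≗δ′ i)))
    where open Multigraph G

  θ⁺-bump : ∀ G δ S p → θ⁺ G (λ i → indicator p i ℕ.+ δ i) S ≈ ι * (θ⁺ G δ S - χ (S p) * θ⁺ G δ (S [ p ]≔ false))
  θ⁺-bump G δ S p = begin
    θ⁺ G (λ i → indicator p i ℕ.+ δ i) S
      ≈⟨ sumSub-affine m per-subset ⟩
    sumSub m (λ s → ι * term S s) + - (ι * χ (S p)) * θ⁺ G δ (S [ p ]≔ false)
      ≈⟨ +-congʳ (sumSub-* m ι (term S)) ⟩
    ι * θ⁺ G δ S + - (ι * χ (S p)) * θ⁺ G δ (S [ p ]≔ false)
      ≈⟨ solve 4 (λ I X T T′ → I :* T :+ (:- (I :* X)) :* T′ := I :* (T :- X :* T′)) refl ι (χ (S p)) _ _ ⟩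
    ι * (θ⁺ G δ S - χ (S p) * θ⁺ G δ (S [ p ]≔ false)) ∎
    where
    open Multigraph G
    term : (Fin n → Bool) → Subset m → Carrier
    term T s = pow β ∣ s ∣ * prodR n (λ i → φ (T i) (δ i ℕ.+ degIn G s i))
    per-subset : ∀ s → pow β ∣ s ∣ * prodR n (λ i → φ (S i) (indicator p i ℕ.+ δ i ℕ.+ degIn G s i))
                       ≈ ι * term S s + - (ι * χ (S p)) * term (S [ p ]≔ false) s
    per-subset s = begin
      pow β ∣ s ∣ * prodR n (λ i → φ (S i) (indicator p i ℕ.+ δ i ℕ.+ d i))
        ≈⟨ *-congˡ (trans (prodR-cong n (reflexive ∘ bumped)) (prodR-[]≔ n g p _)) ⟩
      pow β ∣ s ∣ * (φ (S p) (suc (δ p ℕ.+ d p)) * rest)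
        ≈⟨ *-congˡ (*-congʳ (φ-suc (S p) (δ p ℕ.+ d p))) ⟩
      pow β ∣ s ∣ * (ι * (φ (S p) (δ p ℕ.+ d p) - χ (S p) * φ false (δ p ℕ.+ d p)) * rest)
        ≈⟨ solve 6 (λ B I X F F′ Rs → B :* (I :* (F :- X :* F′) :* Rs) := I :* (B :* (F :* Rs)) :+ (:- (I :* X)) :* (B :* (F′ :* Rs)))
                   refl (pow β ∣ s ∣) ι (χ (S p)) _ _ rest ⟩
      ι * (pow β ∣ s ∣ * (φ (S p) (δ p ℕ.+ d p) * rest)) + - (ι * χ (S p)) * (pow β ∣ s ∣ * (φ false (δ p ℕ.+ d p) * rest))
        ≈⟨ +-cong (*-congˡ (*-congˡ (prodR-pick n g p))) (*-congˡ (*-congˡ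
             (trans (prodR-cong n (reflexive ∘ []≔-map (λ i σ → φ σ (δ i ℕ.+ d i)) S p false)) (prodR-[]≔ n g p _)))) ⟨
      ι * term S s + - (ι * χ (S p)) * term (S [ p ]≔ false) s ∎
      where
      d = degIn G s
      g : Fin n → Carrier
      g i = φ (S i) (δ i ℕ.+ d i)
      rest = prodR n (g [ p ]≔ 1#)
      bumped : (λ i → φ (S i) (indicator p i ℕ.+ δ i ℕ.+ d i)) ≗ g [ p ]≔ φ (S p) (suc (δ p ℕ.+ d p))
      bumped i with p ≟ i
      ... | yes ≡.refl = ≡.refl
      ... | no _       = ≡.refl

  θ-edgeless : ∀ {n} (ends : Fin 0 → Fin n × Fin n) S → θ (graph ends) S ≈ 1#
  θ-edgeless {n} ends S = trans (*-identityˡ _) (prodR-ones n φ-zero)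
    where
    φ-zero : ∀ i → φ (S i) 0 ≈ 1#
    φ-zero i with S i
    ... | true  = refl
    ... | false = refl

  module _ {n m : ℕ} (ends : Fin (suc m) → Fin n × Fin n) where
    open EdgeZero ends

    θ-delete : ∀ S → θ G S ≈ θ G∖0 S + β * θ⁺ G∖0 (λ i → incid G i zero) S
    θ-delete S = +-congˡ (trans (sumSub-cong m (λ s → *-assoc _ _ _)) (sumSub-* m β _))

    θ-recurrence : ∀ S → let Sa = S [ a ]≔ false in
      θ G S ≈ (1# - β) * θ G∖0 S + β * χ (S a) * θ G∖0 Sa + β * χ (S b) * θ G∖0 (S [ b ]≔ false)
              - β * χ (S a) * χ (Sa b) * θ G∖0 (Sa [ b ]≔ false)
    θ-recurrence S = cancel-ι²+1 (β * (θ G∖0 S - χ (S b) * θ G∖0 Sb - χ (S a) * θ G∖0 Sa + χ (S a) * χ (Sa b) * θ G∖0 Sab))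
      (begin
      θ G S
        ≈⟨ θ-delete S ⟩
      θ G∖0 S + β * θ⁺ G∖0 (λ i → indicator a i ℕ.+ indicator b i) S
        ≈⟨ +-congˡ (*-congˡ (trans (θ⁺-bump G∖0 (indicator b) S a) (*-congˡ (+-cong (bump-b S) (-‿cong (*-congˡ (bump-b Sa))))))) ⟩
      θ G∖0 S + β * (ι * (ι * (θ G∖0 S - χ (S b) * θ G∖0 Sb) - χ (S a) * (ι * (θ G∖0 Sa - χ (Sa b) * θ G∖0 Sab))))
        ≈⟨ solve 9 (λ B I A Bb C X Xa Xb Xab →
               X :+ B :* (I :* (I :* (X :- Bb :* Xb) :- A :* (I :* (Xa :- C :* Xab))))
               := (:1 :- B) :* X :+ B :* A :* Xa :+ B :* Bb :* Xb :- B :* A :* C :* Xab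
                  :+ (I :* I :+ :1) :* (B :* (X :- Bb :* Xb :- A :* Xa :+ A :* C :* Xab)))
             refl β ι (χ (S a)) (χ (S b)) (χ (Sa b)) (θ G∖0 S) (θ G∖0 Sa) (θ G∖0 Sb) (θ G∖0 Sab) ⟩
      (1# - β) * θ G∖0 S + β * χ (S a) * θ G∖0 Sa + β * χ (S b) * θ G∖0 Sb - β * χ (S a) * χ (Sa b) * θ G∖0 Sab
        + (ι * ι + 1#) * (β * (θ G∖0 S - χ (S b) * θ G∖0 Sb - χ (S a) * θ G∖0 Sa + χ (S a) * χ (Sa b) * θ G∖0 Sab)) ∎)
      where
      Sa = S [ a ]≔ false
      Sb = S [ b ]≔ false
      Sab = Sa [ b ]≔ false
      bump-b : ∀ T → θ⁺ G∖0 (indicator b) T ≈ ι * (θ G∖0 T - χ (T b) * θ G∖0 (T [ b ]≔ false))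
      bump-b T = trans (θ⁺-cong G∖0 T (λ i → ≡.sym (ℕ.+-identityʳ (indicator b i)))) (θ⁺-bump G∖0 (λ _ → 0) T b)

module Comparison {c ℓ : Level} (R : CommutativeRing c ℓ) (ι β : CommutativeRing.Carrier R)
                  (ι²≈-1 : CommutativeRing._≈_ R (CommutativeRing._*_ R ι ι) (CommutativeRing.-_ R (CommutativeRing.1# R)))
                  where
  open CommutativeRing R hiding (zero)
  open Ring R
  open RingLemmas R
  open XiSide R β
  open ThetaSide R ι β ι²≈-1
  open ℤ-Solver R using (solve; _:+_; _:*_; _:-_; _:=_; :1)
  open import Relation.Binary.Reasoning.Setoid setoid

  -- The hypothesis on j and k says θ_G^S = (1-β)^{|E|-|S|} Ξ_G^S without dividing by 1-β.
  θ≈Ξ : ∀ {n} m (ends : Fin m → Fin n × Fin n) S j k → j ℕ.+ m ≡ k ℕ.+ count S →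
        pow (1# - β) j * θ (graph ends) S ≈ pow (1# - β) k * Ξ (graph ends) S
  θ≈Ξ zero ends S j k j≡k+|S| = begin
    pow (1# - β) j * θ (graph ends) S          ≈⟨ *-congˡ (θ-edgeless ends S) ⟩
    pow (1# - β) j * 1#                        ≈⟨ *-identityʳ _ ⟩
    pow (1# - β) j                             ≡⟨ cong (pow (1# - β)) (≡.trans (≡.sym (ℕ.+-identityʳ j)) j≡k+|S|) ⟩
    pow (1# - β) (k ℕ.+ count S)               ≈⟨ pow-+ (1# - β) k (count S) ⟩
    pow (1# - β) k * pow (1# - β) (count S)    ≈⟨ *-congˡ (Ξ-edgeless ends S) ⟨
    pow (1# - β) k * Ξ (graph ends) S          ∎
  θ≈Ξ (suc m) ends S j k j+m+1≡k+|S| = begin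
    P * θ G S
      ≈⟨ *-congˡ (θ-recurrence ends S) ⟩
    P * ((1# - β) * θ G∖0 S + β * χa * θ G∖0 Sa + β * χb * θ G∖0 Sb - β * χa * χab * θ G∖0 Sab)
      ≈⟨ solve 9 (λ Be A B C P X Xa Xb Xab →
           P :* ((:1 :- Be) :* X :+ Be :* A :* Xa :+ Be :* B :* Xb :- Be :* A :* C :* Xab)
           := (:1 :- Be) :* P :* X :+ Be :* (A :* (P :* Xa)) :+ Be :* (B :* (P :* Xb)) :- Be :* (A :* (C :* (P :* Xab))))
         refl β χa χb χab P (θ G∖0 S) (θ G∖0 Sa) (θ G∖0 Sb) (θ G∖0 Sab) ⟩
    pow (1# - β) (suc j) * θ G∖0 S + β * (χa * (P * θ G∖0 Sa)) + β * (χb * (P * θ G∖0 Sb)) - β * (χa * (χab * (P * θ G∖0 Sab)))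
      ≈⟨ +-cong (+-cong (+-cong (IH S (suc j) k for-S)
                                (*-congˡ (χ-guard (S a) (IH Sa j k ∘ for-Sa))))
                        (*-congˡ (χ-guard (S b) (IH Sb j k ∘ for-Sb))))
                (-‿cong (*-congˡ (χ-guard (S a) λ a∈S → χ-guard (Sa b) (IH Sab j (suc k) ∘ for-Sab a∈S)))) ⟩
    Q * Ξ G∖0 S + β * (χa * (Q * Ξ G∖0 Sa)) + β * (χb * (Q * Ξ G∖0 Sb)) - β * (χa * (χab * (pow (1# - β) (suc k) * Ξ G∖0 Sab)))
      ≈⟨ solve 9 (λ Be A B C Q Y Ya Yb Yab →
           Q :* Y :+ Be :* (A :* (Q :* Ya)) :+ Be :* (B :* (Q :* Yb)) :- Be :* (A :* (C :* ((:1 :- Be) :* Q :* Yab)))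
           := Q :* (Y :+ Be :* A :* Ya :+ Be :* B :* Yb :- Be :* (:1 :- Be) :* A :* C :* Yab))
         refl β χa χb χab Q (Ξ G∖0 S) (Ξ G∖0 Sa) (Ξ G∖0 Sb) (Ξ G∖0 Sab) ⟩
    Q * (Ξ G∖0 S + β * χa * Ξ G∖0 Sa + β * χb * Ξ G∖0 Sb - β * (1# - β) * χa * χab * Ξ G∖0 Sab)
      ≈⟨ *-congˡ (Ξ-recurrence ends S) ⟨
    Q * Ξ G S ∎
    where
    open EdgeZero ends
    IH = θ≈Ξ m (ends ∘ suc)
    P = pow (1# - β) j
    Q = pow (1# - β) k
    Sa = S [ a ]≔ false
    Sb = S [ b ]≔ false
    Sab = Sa [ b ]≔ false
    χa = χ (S a)
    χb = χ (S b)
    χab = χ (Sa b)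
    peel : ∀ {x} → j ℕ.+ suc m ≡ k ℕ.+ suc x → j ℕ.+ m ≡ k ℕ.+ x
    peel {x} e = ℕ.suc-injective (≡.trans (≡.sym (ℕ.+-suc j m)) (≡.trans e (ℕ.+-suc k x)))
    for-S : suc j ℕ.+ m ≡ k ℕ.+ count S
    for-S = ≡.trans (≡.sym (ℕ.+-suc j m)) j+m+1≡k+|S|
    for-Sa : S a ≡ true → j ℕ.+ m ≡ k ℕ.+ count Sa
    for-Sa a∈S = peel (≡.trans j+m+1≡k+|S| (cong (k ℕ.+_) (count-[]≔-false S a a∈S)))
    for-Sb : S b ≡ true → j ℕ.+ m ≡ k ℕ.+ count Sb
    for-Sb b∈S = peel (≡.trans j+m+1≡k+|S| (cong (k ℕ.+_) (count-[]≔-false S b b∈S)))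
    for-Sab : S a ≡ true → Sa b ≡ true → j ℕ.+ m ≡ suc k ℕ.+ count Sab
    for-Sab a∈S b∈Sa = ≡.trans (for-Sa a∈S) (≡.trans (cong (k ℕ.+_) (count-[]≔-false Sa b b∈Sa)) (ℕ.+-suc k _))

  module _ (G : Multigraph) where
    open Multigraph G

    θ≈Ξ-few-edges : m ℕ.≤ n → pow (1# - β) (n ∸ m) * θ G (λ _ → true) ≈ Ξ G (λ _ → true)
    θ≈Ξ-few-edges m≤n =
      trans (θ≈Ξ m ends _ (n ∸ m) 0 (≡.trans (ℕ.m∸n+n≡m m≤n) (≡.sym (count-true n)))) (*-identityˡ _)

    θ≈Ξ-many-edges : n < m → θ G (λ _ → true) ≈ pow (1# - β) (m ∸ n) * Ξ G (λ _ → true)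
    θ≈Ξ-many-edges n<m = trans (sym (*-identityˡ _)) (θ≈Ξ m ends _ 0 (m ∸ n)
      (≡.trans (≡.sym (ℕ.m∸n+n≡m (ℕ.<⇒≤ n<m))) (cong ((m ∸ n) ℕ.+_) (≡.sym (count-true n)))))

theorem7p14 : ∀ {c ℓ : Level} (R : CommutativeRing c ℓ) (G : Multigraph)
    (ι β u : CommutativeRing.Carrier R) →
    CommutativeRing._≈_ R (CommutativeRing._*_ R ι ι) (CommutativeRing.-_ R (CommutativeRing.1# R)) →
    (Multigraph.n G < Multigraph.m G →
    CommutativeRing._≈_ R (CommutativeRing._*_ R u (CommutativeRing._-_ R (CommutativeRing.1# R) β)) (CommutativeRing.1# R)) →
    CommutativeRing._≈_ R (Ring.omega R G ι β u)
    (Ring.Xi R G (CommutativeRing.-_ R β) (Ring.lam R G β))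
theorem7p14 R G ι β u ι²≈-1 u-inverse = ω≈Ξ
  where
  open Multigraph G
  open CommutativeRing R hiding (zero)
  open Ring R
  open RingLemmas R using (pow-inverse)
  open XiSide R β using (Ξ)
  open ThetaSide R ι β ι²≈-1 using (θ)
  open Comparison R ι β ι²≈-1
  open import Algebra.Properties.CommutativeSemigroup *-commutativeSemigroup using (xy∙z≈xz∙y)
  open import Relation.Binary.Reasoning.Setoid setoid
  -- θ G V and Ξ G V unfold to theta G β (ι + ι) and Xi G (- β) (lam G β).
  V : Fin n → Bool
  V _ = true
  ω≈Ξ : omega G ι β u ≈ Xi G (- β) (lam G β)
  ω≈Ξ with m ≤? n
  ... | yes m≤n = trans (*-comm _ _) (θ≈Ξ-few-edges G m≤n)
  ... | no m≰n = begin
    θ G V * pow u (m ∸ n)                           ≈⟨ *-congʳ (θ≈Ξ-many-edges G n<m) ⟩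
    pow (1# - β) (m ∸ n) * Ξ G V * pow u (m ∸ n)    ≈⟨ xy∙z≈xz∙y _ _ _ ⟩
    pow (1# - β) (m ∸ n) * pow u (m ∸ n) * Ξ G V    ≈⟨ *-congʳ (pow-inverse (m ∸ n) (trans (*-comm _ _) (u-inverse n<m))) ⟩
    1# * Ξ G V                                      ≈⟨ *-identityˡ _ ⟩
    Ξ G V                                           ∎
    where
    n<m : n < m
    n<m = ℕ.≰⇒> m≰n
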